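{- Let $(G,A,k,\ell)$ be an instance of $(A,\ell)$-Path Packing. Let $M\subseteq V(G)$ be such that $G-M$ is a disjoint union of cliques, with $m=|M|$, and fix a marking of $V(G)\setminus M$ produced by the marking procedure described in the context. Let $Q$ be a clique of $G-M$, let $u,v\in A\cap V(Q)$ be two distinct unmarked vertices, and let $X\subseteq V(Q)\setminus A$ be a set of exactly $\ell-2$ unmarked vertices. Then $(G,A,k,\ell)$ is a yes-instance if and only if $(G-(X\cup\{u,v\}),\,A\setminus\{u,v\},\,k-1,\,\ell)$ is a yes-instance.
   Context: For an undirected graph $G$ and $A\subseteq V(G)$, an $A$-path is a path in $G$ that starts and ends at two distinct vertices of $A$ and whose internal vertices all lie in $V(G)\setminus A$. $(A,\ell)$-Path Packing asks, given $G$, $A\subseteq V(G)$ and integers $k,\ell$, whether $G$ has $k$ pairwise vertex-disjoint $A$-paths each of length exactly $\ell$. Consistent with this paper's usage, the length of a path is its number of vertices. Marking procedure. Let $M\subseteq V(G)$ be such that $G-M$ is a disjoint union of cliques, and let $m=|M|$. Carry out the following for every clique $Q$ of $G-M$: (1) For each $u\in M$, mark $\ell m+1$ vertices of $N(u)\cap A\cap V(Q)$ (all of them if there are fewer). Likewise, mark $\ell m+1$ vertices of $N(u)\cap (V(Q)\setminus A)$ (all of them if there are fewer). (2) For each pair $u,v\in M$, mark $\ell m+1$ common neighbours of $u$ and $v$ in $V(Q)\setminus A$ (all of them if there are fewer). (3) Additionally, mark $\ell m+1$ vertices of $A\cap V(Q)$ and $\ell m+1$ vertices of $V(Q)\setminus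 A$ (all of them if there are fewer). The choices of which vertices to mark are arbitrary. -}

module Defs where

open import Data.Nat using (ℕ; _+_; _*_; _⊓_)
open import Data.Bool using (Bool; true; false; T)
open import Data.Fin using (Fin)
open import Data.Fin.Subset using (Subset; _∈_; _∉_; _⊆_; _∩_; _∪_; ∁; ∣_∣; Nonempty)
open import Data.Vec using (tabulate)
open import Data.List using (List; []; _∷_; _++_; [_]; length)
open import Data.List.Relation.Unary.All using (All)
open import Data.List.Relation.Unary.Linked using (Linked)
open import Data.List.Relation.Unary.Unique.Propositional using (Unique)
open import Data.List.Relation.Unary.AllPairs using (AllPairs)
import Data.List.Membership.Propositional as LMem
open import Data.Product using (Σ; ∃; _×_)
open import Data.Sum using (_⊎_)
open import Data.Empty using (⊥)
open import Relation.Nullary using (¬_)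
open import Relation.Binary.PropositionalEquality using (_≡_; _≢_)
open import Function.Bundles using (_⇔_)

record Graph (n : ℕ) : Set where
  field
    adj   : Fin n → Fin n → Bool
    sym   : ∀ x y → adj x y ≡ adj y x
    irref : ∀ x → adj x x ≡ false
open Graph public

module _ {n : ℕ} (G : Graph n) where

  Adj : Fin n → Fin n → Set
  Adj x y = T (adj G x y)

  N : Fin n → Subset n
  N u = tabulate (adj G u)

  -- A path in the induced subgraph G[S]: a list of distinct vertices of S,
  -- consecutive ones adjacent. Its length is the number of vertices.
  IsPathIn : Subset n → List (Fin n) → Set
  IsPathIn S p = Unique p × All (_∈ S) p × Linked Adj p

  IsAPathIn : Subset n → Subset n → ℕ → List (Fin n) → Set
  IsAPathIn S A ℓ p =
    IsPathIn S p × length p ≡ ℓ ×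
    Σ (Fin n) λ a → Σ (Fin n) λ b → Σ (List (Fin n)) λ mid →
      p ≡ a ∷ (mid ++ [ b ]) × a ∈ A × b ∈ A × a ≢ b × All (_∉ A) mid

  VertexDisjoint : List (Fin n) → List (Fin n) → Set
  VertexDisjoint p q = ∀ x → x LMem.∈ p → x LMem.∈ q → ⊥

  -- (G[S], A, k, ℓ) is a yes-instance of (A,ℓ)-Path Packing:
  -- k pairwise vertex-disjoint A-paths in G[S], each with exactly ℓ vertices.
  YesInstance : Subset n → Subset n → ℕ → ℕ → Set
  YesInstance S A k ℓ =
    Σ (List (List (Fin n))) λ ps →
      length ps ≡ k × All (IsAPathIn S A ℓ) ps × AllPairs VertexDisjoint ps

  CliqueUnion : Subset n → Set
  CliqueUnion M = ∀ x y z → x ∉ M → y ∉ M → z ∉ M →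
    Adj x y → Adj y z → x ≢ z → Adj x z

  -- Q is (the vertex set of) one of the cliques of G - M, i.e. a connected
  -- component of G - M.
  IsCliqueOf : Subset n → Subset n → Set
  IsCliqueOf M Q = Nonempty Q ×
    (∀ y → y ∈ Q → ∀ x → (x ∈ Q) ⇔ (x ∉ M × (x ≡ y ⊎ Adj x y)))

  -- the vertices chosen by the marking procedure inside one clique Q
  record Choices (M A Q : Subset n) (ℓ : ℕ) : Set where
    field
      SA : Fin n → Subset n
      SN : Fin n → Subset n
      SP : Fin n → Fin n → Subset n
      TA : Subset n
      TN : Subset n
      SA-ok : ∀ u → u ∈ M →
        SA u ⊆ (N u ∩ (A ∩ Q)) ×
        ∣ SA u ∣ ≡ (ℓ * ∣ M ∣ + 1) ⊓ ∣ N u ∩ (A ∩ Q) ∣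
      SN-ok : ∀ u → u ∈ M →
        SN u ⊆ (N u ∩ (Q ∩ ∁ A)) ×
        ∣ SN u ∣ ≡ (ℓ * ∣ M ∣ + 1) ⊓ ∣ N u ∩ (Q ∩ ∁ A) ∣
      SP-ok : ∀ u v → u ∈ M → v ∈ M → u ≢ v →
        SP u v ⊆ ((N u ∩ N v) ∩ (Q ∩ ∁ A)) ×
        ∣ SP u v ∣ ≡ (ℓ * ∣ M ∣ + 1) ⊓ ∣ (N u ∩ N v) ∩ (Q ∩ ∁ A) ∣
      SP-sym : ∀ u v → SP u v ≡ SP v u     -- one choice per unordered pair
      TA-ok : TA ⊆ (A ∩ Q) × ∣ TA ∣ ≡ (ℓ * ∣ M ∣ + 1) ⊓ ∣ A ∩ Q ∣
      TN-ok : TN ⊆ (Q ∩ ∁ A) × ∣ TN ∣ ≡ (ℓ * ∣ M ∣ + 1) ⊓ ∣ Q ∩ ∁ A ∣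

  MarkedBy : {M A Q : Subset n} {ℓ : ℕ} → Choices M A Q ℓ → Fin n → Set
  MarkedBy {M} c x =
      (∃ λ u → u ∈ M × x ∈ Choices.SA c u)
    ⊎ (∃ λ u → u ∈ M × x ∈ Choices.SN c u)
    ⊎ (∃ λ u → ∃ λ v → u ∈ M × v ∈ M × u ≢ v × x ∈ Choices.SP c u v)
    ⊎ x ∈ Choices.TA c
    ⊎ x ∈ Choices.TN c

  -- mk is a marking of V(G) ∖ M produced by the marking procedure
  -- (with parameters A, ℓ): in every clique Q of G - M, the marked vertices
  -- are exactly those chosen by some run of steps (1)-(3) on Q.
  IsMarking : Subset n → Subset n → ℕ → Subset n → Set
  IsMarking M A ℓ mk = mk ⊆ ∁ M ×
    (∀ Q → IsCliqueOf M Q → Σ (Choices M A Q ℓ) λ c →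
       ∀ x → x ∈ Q → (x ∈ mk ⇔ MarkedBy c x))

{-# OPTIONS --safe #-}
-- Backward direction: add the path u, X, v, which lies inside the clique Q.
-- Forward direction: split a solution into the paths inside Q and those leaving Q. Since Q is a
-- connected component of G − M, a path leaving Q passes through M, so it has at most ℓ vertices
-- in Q for each vertex of M it uses, and the paths leaving Q use at most ℓ·|M| vertices of Q.
-- Let z ∈ X ∪ {u, v} lie on one of them. Being unmarked, z has ℓ·|M| + 1 marked stand-ins in Q
-- on its side of A and adjacent to those neighbours of z on the path that lie in M (the other
-- neighbours lie in the clique Q); an unused one replaces z. Every path inside Q has two
-- vertices in A ∩ Q and |X| in Q ∖ A, so after forgetting those paths there is room to build
-- all but one of them anew inside Q, away from X ∪ {u, v}; without such paths, one rerouted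
-- path is dropped.
module Submission where

open import Defs hiding (sym)
open import Data.Bool using (T)
open import Data.Bool.Properties using (T-≡)
open import Data.Fin using (Fin; zero; suc)
open import Data.Fin.Properties using (_≟_)
import Data.Fin.Properties as Fin
open import Data.Fin.Subset using (Subset; _∈_; _∉_; _⊆_; _∩_; _∪_; _─_; _-_; ∁; ∣_∣; ⁅_⁆; ⊤; inside; outside)
open import Data.Fin.Subset.Properties
open import Data.Vec using (_∷_; there)
open import Data.Vec.Properties using (lookup∘tabulate; lookup⇒[]=; []=⇒lookup)
open import Data.List using (List; []; _∷_; _++_; [_]; length; filter; concat; allFin; head; last; map)
open import Data.List.Properties
  using (length-++; length-map; length-filter; map-++; concat-++; ++-assoc; ∷-injectiveʳ; ++-conicalʳ;
         filter-++; filter-all; filter-none; filter-accept; filter-reject; filter-some)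
open import Data.List.Membership.Propositional using (find) renaming (_∈_ to _∈ₗ_; _∉_ to _∉ₗ_)
open import Data.List.Membership.Propositional.Properties
  using (∈-++⁺ˡ; ∈-++⁺ʳ; ∈-∃++; ∈-concat⁺′; ∈-concat⁻′; ∈-filter⁺; ∈-filter⁻; ∈-allFin)
open import Data.List.Relation.Unary.All as All using (All; []; _∷_)
import Data.List.Relation.Unary.All.Properties as All
open import Data.List.Relation.Unary.All.Properties using (all-filter; ¬Any⇒All¬)
open import Data.List.Relation.Unary.Any as Any using (Any; here; there)
open import Data.List.Relation.Unary.Any.Properties using (¬Any[])
open import Data.List.Relation.Unary.AllPairs as AllPairs using (AllPairs; []; _∷_)
open import Data.List.Relation.Unary.Unique.Propositional using (Unique)
import Data.List.Relation.Unary.Unique.Propositional.Properties as Unique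
open import Data.List.Relation.Unary.Linked as Linked using (Linked; []; [-]; _∷_; _∷′_)
open import Data.List.Relation.Unary.Linked.Properties using () renaming (++⁺ to Linked-++⁺)
open import Data.List.Relation.Binary.Disjoint.Propositional using (Disjoint)
open import Data.List.Relation.Binary.Permutation.Propositional as ↭ using (_↭_; ↭-refl; ↭-trans; ↭⇒↭ₛ)
open import Data.List.Relation.Binary.Permutation.Propositional.Properties using (↭-length; ++⁺ˡ; shifts; All-resp-↭)
import Data.List.Relation.Binary.Permutation.Setoid.Properties as Permutation
open import Data.Maybe using (Maybe; just; nothing)
import Data.Maybe.Relation.Unary.All as MaybeAll
import Data.Maybe.Relation.Unary.Any as MaybeAny
open import Data.Maybe.Relation.Binary.Connected using (Connected; just; nothing; nothing-just; drop-just)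
import Data.Maybe.Relation.Binary.Connected as Connected
open import Data.Nat using (ℕ; zero; suc; _+_; _∸_; _*_; _≤_; _<_; z≤n; s≤s; z<s; _⊓_)
open import Data.Nat.Properties hiding (_≟_)
open import Data.Product using (∃; ∃₂; _×_; _,_; proj₁; proj₂)
open import Data.Sum using (inj₁; inj₂)
open import Data.Unit using () renaming (⊤ to Unit; tt to unit)
open import Function using (_∘_)
open import Function.Bundles using (_⇔_; mk⇔; Equivalence)
open import Level using (Level)
open import Relation.Binary.Core using (Rel)
open import Relation.Binary.PropositionalEquality
  using (_≡_; _≢_; refl; sym; trans; cong; cong₂; subst; subst₂; setoid; module ≡-Reasoning)
open import Relation.Nullary using (¬_; Dec; yes; no; contradiction; ¬?)
open import Relation.Nullary.Decidable using (_×-dec_)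
open import Relation.Unary using (Decidable)
open import Relation.Unary.Properties using (∁?)

-- Subsets and counting

∈∩⁻ˡ : ∀ {m} {p q : Subset m} {x} → x ∈ p ∩ q → x ∈ p
∈∩⁻ˡ {p = p} {q} = proj₁ ∘ x∈p∩q⁻ p q

∈∩⁻ʳ : ∀ {m} {p q : Subset m} {x} → x ∈ p ∩ q → x ∈ q
∈∩⁻ʳ {p = p} {q} = proj₂ ∘ x∈p∩q⁻ p q

∈∩⁺ : ∀ {m} {p q : Subset m} {x} → x ∈ p → x ∈ q → x ∈ p ∩ q
∈∩⁺ x∈p x∈q = x∈p∩q⁺ (x∈p , x∈q)

x∈p∩q⇒x∉q∩∁p : ∀ {m} {p q : Subset m} {x} → x ∈ p ∩ q → x ∉ q ∩ ∁ p
x∈p∩q⇒x∉q∩∁p x∈p∩q x∈q∩∁p = x∈∁p⇒x∉p (∈∩⁻ʳ x∈q∩∁p) (∈∩⁻ˡ x∈p∩q)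

x∉p-x : ∀ {m} (p : Subset m) x → x ∉ p - x
x∉p-x (inside ∷ p) zero ()
x∉p-x (outside ∷ p) zero ()
x∉p-x (_ ∷ p) (suc x) (there x∈) = x∉p-x p x x∈

∣p∣≤1+∣p-x∣ : ∀ {m} (p : Subset m) x → ∣ p ∣ ≤ suc ∣ p - x ∣
∣p∣≤1+∣p-x∣ (inside ∷ p) zero = s≤s (≤-reflexive (cong ∣_∣ (sym (p─⊥≡p p))))
∣p∣≤1+∣p-x∣ (outside ∷ p) zero = m≤n⇒m≤1+n (≤-reflexive (cong ∣_∣ (sym (p─⊥≡p p))))
∣p∣≤1+∣p-x∣ (inside ∷ p) (suc x) = s≤s (∣p∣≤1+∣p-x∣ p x)
∣p∣≤1+∣p-x∣ (outside ∷ p) (suc x) = ∣p∣≤1+∣p-x∣ p x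

∣p∣≡m⊓∣q∣⇒∣p∣≡m : ∀ {n m} {p q : Subset n} {x} → p ⊆ q → x ∈ q → x ∉ p → ∣ p ∣ ≡ m ⊓ ∣ q ∣ → ∣ p ∣ ≡ m
∣p∣≡m⊓∣q∣⇒∣p∣≡m {m = m} {p} {q} {x} p⊆q x∈q x∉p ∣p∣≡ with m ≤? ∣ q ∣
... | yes m≤∣q∣ = trans ∣p∣≡ (m≤n⇒m⊓n≡m m≤∣q∣)
... | no m≰∣q∣ = contradiction (trans ∣p∣≡ (m≥n⇒m⊓n≡n (<⇒≤ (≰⇒> m≰∣q∣)))) (<⇒≢ ∣p∣<∣q∣)
  where
    p⊆q-x : p ⊆ q - x
    p⊆q-x y∈p = x∈p∧x≢y⇒x∈p-y (p⊆q y∈p) (λ { refl → x∉p y∈p })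
    ∣p∣<∣q∣ : ∣ p ∣ < ∣ q ∣
    ∣p∣<∣q∣ = ≤-<-trans (p⊆q⇒∣p∣≤∣q∣ p⊆q-x) (x∈p⇒∣p-x∣<∣p∣ x∈q)

module _ {n : ℕ} where

  count : Subset n → List (Fin n) → ℕ
  count p xs = length (filter (_∈? p) xs)

  count-∈ : ∀ {p : Subset n} {x} xs → x ∈ p → count p (x ∷ xs) ≡ suc (count p xs)
  count-∈ {p} xs x∈p = cong length (filter-accept (_∈? p) x∈p)

  count-∉ : ∀ {p : Subset n} {x} xs → x ∉ p → count p (x ∷ xs) ≡ count p xs
  count-∉ {p} xs x∉p = cong length (filter-reject (_∈? p) x∉p)

  count-++ : ∀ p xs ys → count p (xs ++ ys) ≡ count p xs + count p ys
  count-++ p xs ys = trans (cong length (filter-++ (_∈? p) xs ys)) (length-++ (filter (_∈? p) xs))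

  count≤length : ∀ p xs → count p xs ≤ length xs
  count≤length p = length-filter (_∈? p)

  count-all : ∀ {p : Subset n} {xs} → All (_∈ p) xs → count p xs ≡ length xs
  count-all {p} xs⊆p = cong length (filter-all (_∈? p) xs⊆p)

  count-none : ∀ {p : Subset n} {xs} → All (_∉ p) xs → count p xs ≡ 0
  count-none {p} xs∉p = cong length (filter-none (_∈? p) xs∉p)

  count-some : ∀ {p : Subset n} {xs} → Any (_∈ p) xs → 0 < count p xs
  count-some {p} = filter-some (_∈? p)

  count-mono : ∀ {p q : Subset n} → p ⊆ q → ∀ xs → count p xs ≤ count q xs
  count-mono p⊆q [] = z≤n
  count-mono {p} {q} p⊆q (x ∷ xs) with x ∈? p | x ∈? q
  ... | yes _   | yes _  = s≤s (count-mono p⊆q xs)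
  ... | yes x∈p | no x∉q = contradiction (p⊆q x∈p) x∉q
  ... | no _    | yes _  = m≤n⇒m≤1+n (count-mono p⊆q xs)
  ... | no _    | no _   = count-mono p⊆q xs

  count-replace : ∀ p xs {z c : Fin n} {ys} → (z ∈ p ⇔ c ∈ p) → count p (xs ++ c ∷ ys) ≡ count p (xs ++ z ∷ ys)
  count-replace p xs {z} {c} {ys} z⇔c = begin
    count p (xs ++ c ∷ ys)        ≡⟨ count-++ p xs (c ∷ ys) ⟩
    count p xs + count p (c ∷ ys) ≡⟨ cong (count p xs +_) (swap-head (z ∈? p)) ⟩
    count p xs + count p (z ∷ ys) ≡⟨ count-++ p xs (z ∷ ys) ⟨
    count p (xs ++ z ∷ ys)        ∎
    where
      open ≡-Reasoning
      swap-head : Dec (z ∈ p) → count p (c ∷ ys) ≡ count p (z ∷ ys)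
      swap-head (yes z∈p) = trans (count-∈ ys (Equivalence.to z⇔c z∈p)) (sym (count-∈ ys z∈p))
      swap-head (no z∉p) = trans (count-∉ ys (z∉p ∘ Equivalence.from z⇔c)) (sym (count-∉ ys z∉p))

  count-replace-< : ∀ p xs {z c : Fin n} {ys} → z ∈ p → c ∉ p → count p (xs ++ c ∷ ys) < count p (xs ++ z ∷ ys)
  count-replace-< p xs {z} {c} {ys} z∈p c∉p = begin-strict
    count p (xs ++ c ∷ ys)        ≡⟨ count-++ p xs (c ∷ ys) ⟩
    count p xs + count p (c ∷ ys) ≡⟨ cong (count p xs +_) (count-∉ ys c∉p) ⟩
    count p xs + count p ys       <⟨ +-monoʳ-< (count p xs) (n<1+n _) ⟩
    count p xs + suc (count p ys) ≡⟨ cong (count p xs +_) (count-∈ ys z∈p) ⟨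
    count p xs + count p (z ∷ ys) ≡⟨ count-++ p xs (z ∷ ys) ⟨
    count p (xs ++ z ∷ ys)        ∎
    where open ≤-Reasoning

  count-ends-in : ∀ {p : Subset n} {a b} mid → a ∈ p → b ∈ p → All (_∉ p) mid → count p (a ∷ mid ++ [ b ]) ≡ 2
  count-ends-in {p} {b = b} mid a∈p b∈p mid∉p =
    trans (count-∈ (mid ++ [ b ]) a∈p)
          (cong suc (trans (count-++ p mid [ b ]) (cong₂ _+_ (count-none mid∉p) (count-∈ [] b∈p))))

  count-ends-out : ∀ {p : Subset n} {a b} mid → a ∉ p → b ∉ p → All (_∈ p) mid → count p (a ∷ mid ++ [ b ]) ≡ length mid
  count-ends-out {p} {b = b} mid a∉p b∉p mid⊆p =
    trans (count-∉ (mid ++ [ b ]) a∉p)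
          (trans (count-++ p mid [ b ]) (trans (cong₂ _+_ (count-all mid⊆p) (count-∉ [] b∉p)) (+-identityʳ _)))

  count-concat : ∀ p {r} (xss : List (List (Fin n))) → All (λ xs → count p xs ≡ r) xss →
    count p (concat xss) ≡ length xss * r
  count-concat p [] [] = refl
  count-concat p (xs ∷ xss) (eq ∷ eqs) = trans (count-++ p xs (concat xss)) (cong₂ _+_ eq (count-concat p xss eqs))

  count-shift : ∀ (p : Subset n) {r} (xs ys : List (Fin n)) t → count p xs ≡ r →
    count p (xs ++ ys) + t * r ≡ count p ys + suc t * r
  count-shift p {r} xs ys t eq = begin
    count p (xs ++ ys) + t * r ≡⟨ cong (_+ t * r) (trans (count-++ p xs ys) (cong (_+ count p ys) eq)) ⟩
    r + count p ys + t * r     ≡⟨ cong (_+ t * r) (+-comm r (count p ys)) ⟩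
    count p ys + r + t * r     ≡⟨ +-assoc (count p ys) r (t * r) ⟩
    count p ys + (r + t * r)   ∎
    where open ≡-Reasoning

  Unique⇒length≤∣p∣ : ∀ {p : Subset n} {xs} → Unique xs → All (_∈ p) xs → length xs ≤ ∣ p ∣
  Unique⇒length≤∣p∣ [] [] = z≤n
  Unique⇒length≤∣p∣ {p} (x≢xs ∷ u) (x∈p ∷ xs⊆p) = ≤-trans (s≤s (Unique⇒length≤∣p∣ u xs⊆p-x)) (x∈p⇒∣p-x∣<∣p∣ x∈p)
    where xs⊆p-x = All.zipWith (λ (y∈p , x≢y) → x∈p∧x≢y⇒x∈p-y y∈p (x≢y ∘ sym)) (xs⊆p , x≢xs)

  count≤∣p∣ : ∀ p {xs} → Unique xs → count p xs ≤ ∣ p ∣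
  count≤∣p∣ p {xs} u = Unique⇒length≤∣p∣ (Unique.filter⁺ (_∈? p) u) (all-filter (_∈? p) xs)

  ∣p∣≤length : ∀ {p : Subset n} xs → (∀ {x} → x ∈ p → x ∈ₗ xs) → ∣ p ∣ ≤ length xs
  ∣p∣≤length {p} [] p⊆[] = ≤-reflexive (trans (cong ∣_∣ (Empty-unique λ (_ , x∈p) → ¬Any[] (p⊆[] x∈p))) (∣⊥∣≡0 n))
  ∣p∣≤length {p} (x ∷ xs) p⊆x∷xs = ≤-trans (∣p∣≤1+∣p-x∣ p x) (s≤s (∣p∣≤length xs p-x⊆xs))
    where
      p-x⊆xs : ∀ {y} → y ∈ p - x → y ∈ₗ xs
      p-x⊆xs y∈p-x with p⊆x∷xs (p─q⊆p p ⁅ x ⁆ y∈p-x)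
      ... | here refl = contradiction y∈p-x (x∉p-x p x)
      ... | there y∈xs = y∈xs

  fresh : ∀ p xs → count p xs < ∣ p ∣ → ∃ λ x → x ∈ p × x ∉ₗ xs
  fresh p xs room with Fin.any? (λ x → x ∈? p ×-dec ¬? (Any.any? (x ≟_) xs))
  ... | yes found = found
  ... | no none = contradiction (∣p∣≤length (filter (_∈? p) xs) p⊆) (<⇒≱ room)
    where
      p⊆ : ∀ {x} → x ∈ p → x ∈ₗ filter (_∈? p) xs
      p⊆ {x} x∈p with Any.any? (x ≟_) xs
      ... | yes x∈xs = ∈-filter⁺ (_∈? p) x∈xs x∈p
      ... | no x∉xs = contradiction (x , x∈p , x∉xs) none

  freshList : ∀ p xs r → count p xs + r ≤ ∣ p ∣ →
    ∃ λ ys → length ys ≡ r × Unique ys × All (_∈ p) ys × All (_∉ₗ xs) ys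
  freshList p xs zero _ = [] , refl , [] , [] , []
  freshList p xs (suc r) room
    with y , y∈p , y∉xs ← fresh p xs (<-≤-trans (m<m+n (count p xs) z<s) room)
    with ys , refl , u , ys⊆p , ys∉y∷xs ←
           freshList p (y ∷ xs) r (≤-trans (≤-reflexive (trans (cong (_+ r) (count-∈ xs y∈p)) (sym (+-suc _ r)))) room)
    = y ∷ ys , refl , All.map (λ x∉ y≡x → x∉ (here (sym y≡x))) ys∉y∷xs ∷ u , y∈p ∷ ys⊆p ,
      y∉xs ∷ All.map (_∘ there) ys∉y∷xs

  enumerate : Subset n → List (Fin n)
  enumerate p = filter (_∈? p) (allFin n)

  enumerate-Unique : ∀ p → Unique (enumerate p)
  enumerate-Unique p = Unique.filter⁺ (_∈? p) {allFin n} (Unique.allFin⁺ n)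

  ∈-enumerate⁺ : ∀ {p : Subset n} {x} → x ∈ p → x ∈ₗ enumerate p
  ∈-enumerate⁺ {p} {x} = ∈-filter⁺ (_∈? p) (∈-allFin x)

  ∈-enumerate⁻ : ∀ {p : Subset n} {x} → x ∈ₗ enumerate p → x ∈ p
  ∈-enumerate⁻ {p} x∈ = proj₂ (∈-filter⁻ (_∈? p) {xs = allFin n} x∈)

  length-enumerate : ∀ p → length (enumerate p) ≡ ∣ p ∣
  length-enumerate p = ≤-antisym (count≤∣p∣ p (Unique.allFin⁺ n)) (∣p∣≤length (enumerate p) ∈-enumerate⁺)

module _ {α : Level} {A : Set α} where

  length-path : ∀ (a : A) mid b → length (a ∷ mid ++ [ b ]) ≡ length mid + 2
  length-path _ mid _ = trans (cong suc (length-++ mid)) (sym (+-suc (length mid) 1))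

  ∈-head : ∀ xs {x : A} → head xs ≡ just x → x ∈ₗ xs
  ∈-head (y ∷ _) refl = here refl

  ∈-last : ∀ xs {x : A} → last xs ≡ just x → x ∈ₗ xs
  ∈-last (y ∷ []) refl = here refl
  ∈-last (y ∷ z ∷ xs) eq = there (∈-last (z ∷ xs) eq)

  head≡just⇒≢[] : ∀ xs {x : A} → head xs ≡ just x → xs ≢ []
  head≡just⇒≢[] [] ()
  head≡just⇒≢[] (_ ∷ _) _ ()

  ∈-init : ∀ {b z : A} mid pre {post} → mid ++ [ b ] ≡ pre ++ z ∷ post → post ≢ [] → z ∈ₗ mid
  ∈-init [] [] eq post≢[] = contradiction (sym (∷-injectiveʳ eq)) post≢[]
  ∈-init [] (_ ∷ pre) eq _ = contradiction (++-conicalʳ pre _ (sym (∷-injectiveʳ eq))) λ ()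
  ∈-init (m ∷ mid) [] refl _ = here refl
  ∈-init (m ∷ mid) (_ ∷ pre) eq post≢[] = there (∈-init mid pre (∷-injectiveʳ eq) post≢[])

  ∈-concat-split : ∀ xss {z : A} → z ∈ₗ concat xss → ∃₂ λ R₁ pre → ∃₂ λ post R₂ → xss ≡ R₁ ++ (pre ++ z ∷ post) ∷ R₂
  ∈-concat-split xss z∈ with ∈-concat⁻′ xss z∈
  ... | xs , z∈xs , xs∈xss with ∈-∃++ xs∈xss | ∈-∃++ z∈xs
  ... | R₁ , R₂ , refl | pre , post , refl = R₁ , pre , post , R₂ , refl

  concat-middle : ∀ R₁ pre (z : A) post R₂ →
    concat (R₁ ++ (pre ++ z ∷ post) ∷ R₂) ≡ (concat R₁ ++ pre) ++ z ∷ post ++ concat R₂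
  concat-middle R₁ pre z post R₂ = begin
    concat (R₁ ++ (pre ++ z ∷ post) ∷ R₂)       ≡⟨ concat-++ R₁ _ ⟨
    concat R₁ ++ (pre ++ z ∷ post) ++ concat R₂ ≡⟨ cong (concat R₁ ++_) (++-assoc pre (z ∷ post) (concat R₂)) ⟩
    concat R₁ ++ pre ++ z ∷ post ++ concat R₂   ≡⟨ ++-assoc (concat R₁) pre _ ⟨
    (concat R₁ ++ pre) ++ z ∷ post ++ concat R₂ ∎
    where open ≡-Reasoning

  concat-↭ : ∀ {xss yss : List (List A)} → xss ↭ yss → concat xss ↭ concat yss
  concat-↭ ↭.refl = ↭-refl
  concat-↭ (↭.prep xs p) = ++⁺ˡ xs (concat-↭ p)
  concat-↭ (↭.swap xs ys p) = ↭-trans (shifts xs ys) (++⁺ˡ ys (++⁺ˡ xs (concat-↭ p)))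
  concat-↭ (↭.trans p q) = ↭-trans (concat-↭ p) (concat-↭ q)

  ↭-filter-split : ∀ {p} {P : A → Set p} (P? : Decidable P) xs → xs ↭ filter P? xs ++ filter (∁? P?) xs
  ↭-filter-split P? [] = ↭-refl
  ↭-filter-split P? (x ∷ xs) with P? x
  ... | yes _ = ↭.prep x (↭-filter-split P? xs)
  ... | no _ = ↭-trans (↭.prep x (↭-filter-split P? xs)) (shifts [ x ] (filter P? xs))

  All-replace : ∀ {p} {P : A → Set p} xs {z c ys} → All P (xs ++ z ∷ ys) → P c → All P (xs ++ c ∷ ys)
  All-replace xs all Pc = All.++⁺ (All.++⁻ˡ xs all) (Pc ∷ All.tail (All.++⁻ʳ xs all))

  Unique-++⁻ : ∀ xs {ys : List A} → Unique (xs ++ ys) → Unique xs × Unique ys × Disjoint xs ys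
  Unique-++⁻ [] u = [] , u , λ ()
  Unique-++⁻ (x ∷ xs) (x∉ ∷ u) with Unique-++⁻ xs u
  ... | uxs , uys , disjoint = All.++⁻ˡ xs x∉ ∷ uxs , uys , λ
    { (here refl , y∈ys) → All.lookup (All.++⁻ʳ xs x∉) y∈ys refl
    ; (there y∈xs , y∈ys) → disjoint (y∈xs , y∈ys) }

  Unique-concat⁻ : ∀ (xss : List (List A)) → Unique (concat xss) → AllPairs Disjoint xss
  Unique-concat⁻ [] _ = []
  Unique-concat⁻ (xs ∷ xss) u with Unique-++⁻ xs u
  ... | _ , u′ , disjoint =
    All.tabulate (λ ys∈xss (x∈xs , x∈ys) → disjoint (x∈xs , ∈-concat⁺′ x∈ys ys∈xss)) ∷ Unique-concat⁻ xss u′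

  Unique-↭ : ∀ {xs ys : List A} → xs ↭ ys → Unique xs → Unique ys
  Unique-↭ xs↭ys = Permutation.Unique-resp-↭ (setoid A) (↭⇒↭ₛ xs↭ys)

  Unique-replace : ∀ xs {z c : A} {ys} → Unique (xs ++ z ∷ ys) → c ∉ₗ xs ++ z ∷ ys → Unique (xs ++ c ∷ ys)
  Unique-replace [] (_ ∷ u) c∉ = All.tabulate (λ y∈ys c≡y → c∉ (there (subst (_∈ₗ _) (sym c≡y) y∈ys))) ∷ u
  Unique-replace (x ∷ xs) (x∉ ∷ u) c∉ =
    All-replace xs x∉ (λ x≡c → c∉ (here (sym x≡c))) ∷ Unique-replace xs u (c∉ ∘ there)

  Unique-ends : ∀ {a b : A} mid → Unique (a ∷ mid ++ [ b ]) → a ≢ b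
  Unique-ends mid (a∉ ∷ _) = All.lookup a∉ (∈-++⁺ʳ mid (here refl))

  Unique-path : ∀ {a b : A} {mid} → a ≢ b → a ∉ₗ mid → b ∉ₗ mid → Unique mid → Unique (a ∷ mid ++ [ b ])
  Unique-path {mid = mid} a≢b a∉mid b∉mid u =
    All.++⁺ (All.tabulate (λ x∈mid a≡x → a∉mid (subst (_∈ₗ mid) (sym a≡x) x∈mid))) (a≢b ∷ []) ∷
    Unique.++⁺ u ([] ∷ []) (λ { (x∈mid , here refl) → b∉mid x∈mid })

  module _ {r : Level} {R : Rel A r} where

    Linked-++⁻ : ∀ xs {ys} → Linked R (xs ++ ys) → Linked R xs × Connected R (last xs) (head ys) × Linked R ys
    Linked-++⁻ [] {[]} l = [] , nothing , l
    Linked-++⁻ [] {_ ∷ _} l = [] , nothing-just , l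
    Linked-++⁻ (x ∷ []) l = [-] , Linked.head′ l , Linked.tail l
    Linked-++⁻ (x ∷ y ∷ xs) (Rxy ∷ l) with Linked-++⁻ (y ∷ xs) l
    ... | lxs , connected , lys = Rxy ∷ lxs , connected , lys

    Linked-neighbours : ∀ pre {z post} → Linked R (pre ++ z ∷ post) →
      Connected R (last pre) (just z) × Connected R (just z) (head post)
    Linked-neighbours pre l with Linked-++⁻ pre l
    ... | _ , before , lzpost = before , Linked.head′ lzpost

    Linked-replace : ∀ pre {z c post} → Linked R (pre ++ z ∷ post) →
      Connected R (last pre) (just c) → Connected R (just c) (head post) → Linked R (pre ++ c ∷ post)
    Linked-replace pre l before after with Linked-++⁻ pre l
    ... | lpre , _ , lzpost = Linked-++⁺ lpre before (after ∷′ Linked.tail lzpost)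

module _ {n : ℕ} where

  count-concat-replace : ∀ p R₁ pre {z c : Fin n} post R₂ → (z ∈ p ⇔ c ∈ p) →
    count p (concat (R₁ ++ (pre ++ c ∷ post) ∷ R₂)) ≡ count p (concat (R₁ ++ (pre ++ z ∷ post) ∷ R₂))
  count-concat-replace p R₁ pre {z} {c} post R₂ z⇔c = begin
    count p (concat (R₁ ++ (pre ++ c ∷ post) ∷ R₂))       ≡⟨ cong (count p) (concat-middle R₁ pre c post R₂) ⟩
    count p ((concat R₁ ++ pre) ++ c ∷ post ++ concat R₂) ≡⟨ count-replace p (concat R₁ ++ pre) z⇔c ⟩
    count p ((concat R₁ ++ pre) ++ z ∷ post ++ concat R₂) ≡⟨ cong (count p) (concat-middle R₁ pre z post R₂) ⟨
    count p (concat (R₁ ++ (pre ++ z ∷ post) ∷ R₂))       ∎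
    where open ≡-Reasoning

  count-concat-replace-< : ∀ p R₁ pre {z c : Fin n} post R₂ → z ∈ p → c ∉ p →
    count p (concat (R₁ ++ (pre ++ c ∷ post) ∷ R₂)) < count p (concat (R₁ ++ (pre ++ z ∷ post) ∷ R₂))
  count-concat-replace-< p R₁ pre {z} {c} post R₂ z∈p c∉p =
    subst₂ _<_ (cong (count p) (sym (concat-middle R₁ pre c post R₂))) (cong (count p) (sym (concat-middle R₁ pre z post R₂)))
      (count-replace-< p (concat R₁ ++ pre) z∈p c∉p)

  replace : Fin n → Fin n → Fin n → Fin n
  replace z c x with x ≟ z
  ... | yes _ = c
  ... | no _ = x

  replace-preserves : ∀ {p} (P : Fin n → Set p) {z c} → (P z → P c) → ∀ {x} → P x → P (replace z c x)
  replace-preserves P {z} Pz⇒Pc {x} Px with x ≟ z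
  ... | yes refl = Pz⇒Pc Px
  ... | no _ = Px

  map-replace-id : ∀ {z c} xs → z ∉ₗ xs → map (replace z c) xs ≡ xs
  map-replace-id [] _ = refl
  map-replace-id {z} (x ∷ xs) z∉ with x ≟ z
  ... | yes refl = contradiction (here refl) z∉
  ... | no _ = cong (x ∷_) (map-replace-id xs (z∉ ∘ there))

  map-replace : ∀ {z c} pre {post} → z ∉ₗ pre → z ∉ₗ post → map (replace z c) (pre ++ z ∷ post) ≡ pre ++ c ∷ post
  map-replace {z} {c} pre {post} z∉pre z∉post =
    trans (map-++ (replace z c) pre (z ∷ post))
          (cong₂ _++_ (map-replace-id pre z∉pre) (cong₂ _∷_ replace-z (map-replace-id post z∉post)))
    where
      replace-z : replace z c z ≡ c
      replace-z with z ≟ z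
      ... | yes _ = refl
      ... | no z≢z = contradiction refl z≢z

-- Paths and packings

module _ {n : ℕ} (G : Graph n) where

  Adj-sym : ∀ {x y} → Adj G x y → Adj G y x
  Adj-sym {x} {y} = subst T (Graph.sym G x y)

  ∈N⁺ : ∀ {w x} → Adj G w x → x ∈ N G w
  ∈N⁺ {w} {x} w~x = lookup⇒[]= x (N G w) (trans (lookup∘tabulate (adj G w) x) (Equivalence.to T-≡ w~x))

  ∈N⁻ : ∀ {w x} → x ∈ N G w → Adj G w x
  ∈N⁻ {w} {x} x∈N = Equivalence.from T-≡ (trans (sym (lookup∘tabulate (adj G w) x)) ([]=⇒lookup x∈N))

  Packing : Subset n → Subset n → ℕ → List (List (Fin n)) → Set
  Packing S B ℓ ps = All (IsAPathIn G S B ℓ) ps × Unique (concat ps)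

  YesInstance⇒Packing : ∀ {S B k ℓ} → YesInstance G S B k ℓ → ∃ λ ps → length ps ≡ k × Packing S B ℓ ps
  YesInstance⇒Packing (ps , len , paths , disjoint) =
    ps , len , paths ,
    Unique.concat⁺ (All.map (proj₁ ∘ proj₁) paths) (AllPairs.map (λ d {x} (x∈p , x∈q) → d x x∈p x∈q) disjoint)

  Packing⇒YesInstance : ∀ {S B ℓ ps} → Packing S B ℓ ps → YesInstance G S B (length ps) ℓ
  Packing⇒YesInstance {ps = ps} (paths , u) =
    ps , refl , paths , AllPairs.map (λ d x x∈p x∈q → d (x∈p , x∈q)) (Unique-concat⁻ ps u)

  YesInstance-pred : ∀ {S B k ℓ} → YesInstance G S B k ℓ → YesInstance G S B (k ∸ 1) ℓ
  YesInstance-pred {k = zero} solution = solution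
  YesInstance-pred {k = suc k} ([] , () , _)
  YesInstance-pred {k = suc k} (_ ∷ ps , len , _ ∷ paths , _ ∷ disjoint) = ps , suc-injective len , paths , disjoint

  Packing-↭ : ∀ {S B ℓ ps qs} → ps ↭ qs → Packing S B ℓ ps → Packing S B ℓ qs
  Packing-↭ ps↭qs (paths , u) = All-resp-↭ ps↭qs paths , Unique-↭ (concat-↭ ps↭qs) u

  Packing-++⁻ : ∀ {S B ℓ} ps {qs} → Packing S B ℓ (ps ++ qs) → Packing S B ℓ ps × Packing S B ℓ qs
  Packing-++⁻ ps (paths , u) with Unique-++⁻ (concat ps) (subst Unique (sym (concat-++ ps _)) u)
  ... | ups , uqs , _ = (All.++⁻ˡ ps paths , ups) , (All.++⁻ʳ ps paths , uqs)

  Packing-++⁺ : ∀ {S B ℓ ps qs} → Packing S B ℓ ps → Packing S B ℓ qs → Disjoint (concat ps) (concat qs) →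
    Packing S B ℓ (ps ++ qs)
  Packing-++⁺ {ps = ps} {qs} (paths , ups) (paths′ , uqs) disjoint =
    All.++⁺ paths paths′ , subst Unique (concat-++ ps qs) (Unique.++⁺ ups uqs disjoint)

  distinct×interior-∉ : ∀ {S B ℓ} pre {z post x y} → IsAPathIn G S B ℓ (pre ++ z ∷ post) →
    last pre ≡ just x → head post ≡ just y → x ≢ y × z ∉ B
  distinct×interior-∉ (p₀ ∷ pre) {post = post} ((u , _) , _ , _ , _ , mid , eq , _ , _ , _ , mid∉B) last≡ head≡ =
    (λ { refl → proj₂ (proj₂ (Unique-++⁻ (p₀ ∷ pre) u)) (∈-last (p₀ ∷ pre) last≡ , there (∈-head post head≡)) }) ,
    All.lookup mid∉B (∈-init mid pre (sym (∷-injectiveʳ eq)) (head≡just⇒≢[] post head≡))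

  IsAPathIn-replace : ∀ {S B ℓ} pre {z c post} → IsAPathIn G S B ℓ (pre ++ z ∷ post) →
    c ∈ S → c ∉ₗ pre ++ z ∷ post → (z ∈ B ⇔ c ∈ B) →
    Connected (Adj G) (last pre) (just c) → Connected (Adj G) (just c) (head post) →
    IsAPathIn G S B ℓ (pre ++ c ∷ post)
  IsAPathIn-replace {B = B} pre {z} {c} {post} ((u , p⊆S , linked) , len , a , b , mid , eq , a∈B , b∈B , _ , mid∉B)
                    c∈S c∉p z⇔c before after =
    (u′ , All-replace pre p⊆S c∈S , Linked-replace pre linked before after) ,
    trans (cong length (sym image)) (trans (length-map f (pre ++ z ∷ post)) len) ,
    f a , f b , map f mid , shape , keepB a∈B , keepB b∈B , Unique-ends (map f mid) (subst Unique shape u′) ,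
    All.map⁺ (All.map (replace-preserves (_∉ B) (λ z∉B → z∉B ∘ Equivalence.from z⇔c)) mid∉B)
    where
      f = replace z c
      keepB = replace-preserves (_∈ B) (Equivalence.to z⇔c)
      u′ = Unique-replace pre u c∉p
      split = Unique-++⁻ pre u
      image : map f (pre ++ z ∷ post) ≡ pre ++ c ∷ post
      image = map-replace pre (λ z∈pre → proj₂ (proj₂ split) (z∈pre , here refl))
                              (Unique.Unique[x∷xs]⇒x∉xs (proj₁ (proj₂ split)))
      shape : pre ++ c ∷ post ≡ f a ∷ map f mid ++ [ f b ]
      shape = begin
        pre ++ c ∷ post            ≡⟨ image ⟨
        map f (pre ++ z ∷ post)    ≡⟨ cong (map f) eq ⟩
        f a ∷ map f (mid ++ [ b ]) ≡⟨ cong (f a ∷_) (map-++ f mid [ b ]) ⟩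
        f a ∷ map f mid ++ [ f b ] ∎
        where open ≡-Reasoning

  Packing-replace : ∀ {S B ℓ} R₁ pre {z c post} R₂ → Packing S B ℓ (R₁ ++ (pre ++ z ∷ post) ∷ R₂) →
    c ∈ S → c ∉ₗ concat (R₁ ++ (pre ++ z ∷ post) ∷ R₂) → (z ∈ B ⇔ c ∈ B) →
    Connected (Adj G) (last pre) (just c) → Connected (Adj G) (just c) (head post) →
    Packing S B ℓ (R₁ ++ (pre ++ c ∷ post) ∷ R₂)
  Packing-replace R₁ pre {z} {c} {post} R₂ (paths , u) c∈S c∉ z⇔c before after =
    All.++⁺ (All.++⁻ˡ R₁ paths) (path′ ∷ All.tail (All.++⁻ʳ R₁ paths)) ,
    subst Unique (sym (concat-middle R₁ pre c post R₂))
      (Unique-replace (concat R₁ ++ pre) (subst Unique (concat-middle R₁ pre z post R₂) u)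
                      (subst (c ∉ₗ_) (concat-middle R₁ pre z post R₂) c∉))
    where
      path′ = IsAPathIn-replace pre (All.head (All.++⁻ʳ R₁ paths)) c∈S
                (λ c∈p → c∉ (∈-concat⁺′ c∈p (∈-++⁺ʳ R₁ (here refl)))) z⇔c before after

  module _ {A Z D : Subset n} {ℓ : ℕ} (D⊆Z : D ⊆ Z) where

    restrict : ∀ {p} → IsAPathIn G ⊤ A ℓ p → All (_∉ Z) p → IsAPathIn G (∁ Z) (A ─ D) ℓ p
    restrict ((u , _ , linked) , len , a , b , mid , refl , a∈A , b∈A , a≢b , mid∉A) p∉Z =
      (u , All.map x∉p⇒x∈∁p p∉Z , linked) , len , a , b , mid , refl ,
      x∈p∧x∉q⇒x∈p─q a∈A (All.head p∉Z ∘ D⊆Z) ,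
      x∈p∧x∉q⇒x∈p─q b∈A (All.head (All.++⁻ʳ mid (All.tail p∉Z)) ∘ D⊆Z) ,
      a≢b , All.map (λ x∉A → x∉A ∘ p─q⊆p A D) mid∉A

    lift : ∀ {p} → IsAPathIn G (∁ Z) (A ─ D) ℓ p → IsAPathIn G ⊤ A ℓ p
    lift ((u , p⊆∁Z , linked) , len , a , b , mid , refl , a∈A′ , b∈A′ , a≢b , mid∉A′) =
      (u , All.map (λ _ → ∈⊤) p⊆∁Z , linked) , len , a , b , mid , refl , p─q⊆p A D a∈A′ , p─q⊆p A D b∈A′ , a≢b ,
      All.zipWith (λ (x∈∁Z , x∉A′) x∈A → x∉A′ (x∈p∧x∉q⇒x∈p─q x∈A (x∈∁p⇒x∉p x∈∁Z ∘ D⊆Z)))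
                  (All.++⁻ˡ mid (All.tail p⊆∁Z) , mid∉A′)

    restrict-Packing : ∀ {ps} → Packing ⊤ A ℓ ps → All (_∉ Z) (concat ps) → Packing (∁ Z) (A ─ D) ℓ ps
    restrict-Packing (paths , u) ps∉Z = All.zipWith (λ (path , p∉Z) → restrict path p∉Z) (paths , All.concat⁻ ps∉Z) , u

-- The clique Q

module Component {n : ℕ} (G : Graph n) {M Q : Subset n} (isComponent : IsCliqueOf G M Q) where

  clique : ∀ {x y} → x ∈ Q → y ∈ Q → x ≢ y → Adj G x y
  clique {x} x∈Q y∈Q x≢y with Equivalence.to (proj₂ isComponent _ y∈Q x) x∈Q
  ... | _ , inj₁ x≡y = contradiction x≡y x≢y
  ... | _ , inj₂ x~y = x~y

  attach : ∀ {x y} → y ∈ Q → x ∉ M → Adj G x y → x ∈ Q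
  attach {x} y∈Q x∉M x~y = Equivalence.from (proj₂ isComponent _ y∈Q x) (x∉M , inj₂ x~y)

  Linked-clique : ∀ {xs} → Unique xs → All (_∈ Q) xs → Linked (Adj G) xs
  Linked-clique [] [] = []
  Linked-clique (_ ∷ []) (_ ∷ []) = [-]
  Linked-clique ((x≢y ∷ _) ∷ u) (x∈Q ∷ y∈Q ∷ xs⊆Q) = clique x∈Q y∈Q x≢y ∷ Linked-clique u (y∈Q ∷ xs⊆Q)

  spread : ∀ {xs} → Linked (Adj G) xs → All (_∉ M) xs → Any (_∈ Q) xs → All (_∈ Q) xs
  spread [] _ ()
  spread [-] _ (here x∈Q) = x∈Q ∷ []
  spread (x~y ∷ l) (_ ∷ y∉M ∷ xs∉M) (here x∈Q) =
    x∈Q ∷ spread l (y∉M ∷ xs∉M) (here (attach x∈Q y∉M (Adj-sym G x~y)))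
  spread (x~y ∷ l) (x∉M ∷ xs∉M) (there meetsQ) with spread l xs∉M meetsQ
  ... | y∈Q ∷ xs⊆Q = attach y∈Q x∉M x~y ∷ y∈Q ∷ xs⊆Q

  count-outside : ∀ {p} → Linked (Adj G) p → ¬ All (_∈ Q) p → count Q p ≤ length p * count M p
  count-outside {p} linked p⊈Q with Any.any? (_∈? M) p
  ... | yes meetsM = begin
    count Q p            ≤⟨ count≤length Q p ⟩
    length p             ≡⟨ *-identityʳ (length p) ⟨
    length p * 1         ≤⟨ *-monoʳ-≤ (length p) (count-some meetsM) ⟩
    length p * count M p ∎
    where open ≤-Reasoning
  ... | no avoidsM with Any.any? (_∈? Q) p
  ...   | yes meetsQ = contradiction (spread linked (¬Any⇒All¬ p avoidsM) meetsQ) p⊈Q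
  ...   | no avoidsQ = subst (_≤ _) (sym (count-none (¬Any⇒All¬ p avoidsQ))) z≤n

  count-outside-concat : ∀ {S B ℓ} ps → All (IsAPathIn G S B ℓ) ps → All (λ p → ¬ All (_∈ Q) p) ps →
    count Q (concat ps) ≤ ℓ * count M (concat ps)
  count-outside-concat [] [] [] = z≤n
  count-outside-concat {ℓ = ℓ} (p ∷ ps) (((_ , _ , linked) , len , _) ∷ paths) (p⊈Q ∷ ps⊈Q) = begin
    count Q (p ++ concat ps)                ≡⟨ count-++ Q p (concat ps) ⟩
    count Q p + count Q (concat ps)         ≤⟨ +-mono-≤ (subst (λ k → count Q p ≤ k * count M p) len (count-outside linked p⊈Q))
                                                        (count-outside-concat ps paths ps⊈Q) ⟩
    ℓ * count M p + ℓ * count M (concat ps) ≡⟨ *-distribˡ-+ ℓ (count M p) (count M (concat ps)) ⟨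
    ℓ * (count M p + count M (concat ps))   ≡⟨ cong (ℓ *_) (count-++ M p (concat ps)) ⟨
    ℓ * count M (p ++ concat ps)            ∎
    where open ≤-Reasoning

  reattachˡ : ∀ {w z c} → Connected (Adj G) w (just z) → z ∈ Q → c ∈ Q → (∀ {x} → w ≡ just x → x ≢ c) →
    MaybeAll.All (λ x → x ∈ M → Adj G x c) w → Connected (Adj G) w (just c)
  reattachˡ nothing-just _ _ _ _ = nothing-just
  reattachˡ {just x} (just x~z) z∈Q c∈Q x≢c (MaybeAll.just viaM) with x ∈? M
  ... | yes x∈M = just (viaM x∈M)
  ... | no x∉M = just (clique (attach z∈Q x∉M x~z) c∈Q (x≢c refl))

  reattachʳ : ∀ {w z c} → Connected (Adj G) (just z) w → z ∈ Q → c ∈ Q → (∀ {x} → w ≡ just x → x ≢ c) →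
    MaybeAll.All (λ x → x ∈ M → Adj G x c) w → Connected (Adj G) (just c) w
  reattachʳ z~w z∈Q c∈Q ≢c viaM = Connected.sym (Adj-sym G) (reattachˡ (Connected.sym (Adj-sym G) z~w) z∈Q c∈Q ≢c viaM)

  cliquePath : ∀ {A : Subset n} {ℓ a b mid} → a ∈ A ∩ Q → b ∈ A ∩ Q → All (_∈ Q ∩ ∁ A) mid →
    Unique (a ∷ mid ++ [ b ]) → length mid + 2 ≡ ℓ → IsAPathIn G ⊤ A ℓ (a ∷ mid ++ [ b ])
  cliquePath {a = a} {b} {mid} a∈AQ b∈AQ mid⊆NA u len =
    (u , All.tabulate {xs = a ∷ mid ++ [ b ]} (λ _ → ∈⊤) ,
     Linked-clique u (∈∩⁻ʳ a∈AQ ∷ All.++⁺ (All.map ∈∩⁻ˡ mid⊆NA) (∈∩⁻ʳ b∈AQ ∷ []))) ,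
    trans (length-path a mid b) len ,
    a , b , mid , refl , ∈∩⁻ˡ a∈AQ , ∈∩⁻ˡ b∈AQ , Unique-ends mid u , All.map (x∈∁p⇒x∉p ∘ ∈∩⁻ʳ) mid⊆NA

  count-inside : ∀ {S A : Subset n} {ℓ p} → IsAPathIn G S A ℓ p → All (_∈ Q) p →
    count (A ∩ Q) p ≡ 2 × count (Q ∩ ∁ A) p + 2 ≡ ℓ
  count-inside (_ , len , a , b , mid , refl , a∈A , b∈A , _ , mid∉A) (a∈Q ∷ p⊆Q) =
    count-ends-in mid (∈∩⁺ a∈A a∈Q) (∈∩⁺ b∈A b∈Q) (All.map (λ x∉A → x∉A ∘ ∈∩⁻ˡ) mid∉A) ,
    trans (cong (_+ 2) (count-ends-out mid (x∈p∩q⇒x∉q∩∁p (∈∩⁺ a∈A a∈Q)) (x∈p∩q⇒x∉q∩∁p (∈∩⁺ b∈A b∈Q))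
                          (All.zipWith (λ (x∈Q , x∉A) → ∈∩⁺ x∈Q (x∉p⇒x∈∁p x∉A)) (All.++⁻ˡ mid p⊆Q , mid∉A))))
          (trans (sym (length-path a mid b)) len)
    where b∈Q = All.head (All.++⁻ʳ mid p⊆Q)

-- Rerouting through marked vertices

module Rerouting {n : ℕ} (G : Graph n) (A : Subset n) (ℓ : ℕ) {M mk Q : Subset n}
                 (marking : IsMarking G M A ℓ mk) (isComponent : IsCliqueOf G M Q) where

  open Component G isComponent

  private
    choices : Choices G M A Q ℓ
    choices = proj₁ (proj₂ marking Q isComponent)
  open Choices choices

  marked : ∀ {x} → x ∈ Q → MarkedBy G choices x → x ∈ mk
  marked x∈Q = Equivalence.from (proj₂ (proj₂ marking Q isComponent) _ x∈Q)

  record Pool (z : Fin n) (Fits : Fin n → Set) : Set where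
    field
      pool      : Subset n
      pool⊆Q    : pool ⊆ Q
      pool⊆mk   : pool ⊆ mk
      ∣pool∣    : ∣ pool ∣ ≡ ℓ * ∣ M ∣ + 1
      pool-side : ∀ {c} → c ∈ pool → z ∈ A ⇔ c ∈ A
      pool-fits : ∀ {c} → c ∈ pool → Fits c

  Pool-map : ∀ {z F F′} → (∀ {c} → F c → F′ c) → Pool z F → Pool z F′
  Pool-map F⇒F′ P = record { Pool P ; pool-fits = F⇒F′ ∘ pool-fits }
    where open Pool P

  -- z ∈ T is unmarked, so S ≠ T and the truncation of ∣ S ∣ to ℓ * ∣ M ∣ + 1 is not the binding one.
  choicePool : ∀ {z Fits} S T → S ⊆ T → ∣ S ∣ ≡ (ℓ * ∣ M ∣ + 1) ⊓ ∣ T ∣ → T ⊆ Q → z ∈ T → z ∉ mk →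
    (∀ {c} → c ∈ S → MarkedBy G choices c) → (∀ {c} → c ∈ T → z ∈ A ⇔ c ∈ A) → (∀ {c} → c ∈ T → Fits c) →
    Pool z Fits
  choicePool S T S⊆T ∣S∣≡ T⊆Q z∈T z∉mk markedBy side fits = record
    { pool = S ; pool⊆Q = T⊆Q ∘ S⊆T ; pool⊆mk = S⊆mk
    ; ∣pool∣ = ∣p∣≡m⊓∣q∣⇒∣p∣≡m S⊆T z∈T (z∉mk ∘ S⊆mk) ∣S∣≡
    ; pool-side = side ∘ S⊆T ; pool-fits = fits ∘ S⊆T }
    where
      S⊆mk : S ⊆ mk
      S⊆mk c∈S = marked (T⊆Q (S⊆T c∈S)) (markedBy c∈S)

  private
    bothIn : ∀ {z c} → z ∈ A → c ∈ A → z ∈ A ⇔ c ∈ A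
    bothIn z∈A c∈A = mk⇔ (λ _ → c∈A) (λ _ → z∈A)

    bothOut : ∀ {z c} → z ∉ A → c ∉ A → z ∈ A ⇔ c ∈ A
    bothOut z∉A c∉A = mk⇔ (λ z∈A → contradiction z∈A z∉A) (λ c∈A → contradiction c∈A c∉A)

  pool₀ : ∀ {z} → z ∈ Q → z ∉ mk → Pool z (λ _ → Unit)
  pool₀ {z} z∈Q z∉mk with z ∈? A
  ... | yes z∈A = choicePool TA (A ∩ Q) (proj₁ TA-ok) (proj₂ TA-ok) ∈∩⁻ʳ (∈∩⁺ z∈A z∈Q) z∉mk
                    (inj₂ ∘ inj₂ ∘ inj₂ ∘ inj₁) (bothIn z∈A ∘ ∈∩⁻ˡ) (λ _ → unit)
  ... | no z∉A = choicePool TN (Q ∩ ∁ A) (proj₁ TN-ok) (proj₂ TN-ok) ∈∩⁻ˡ (∈∩⁺ z∈Q (x∉p⇒x∈∁p z∉A)) z∉mk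
                    (inj₂ ∘ inj₂ ∘ inj₂ ∘ inj₂) (bothOut z∉A ∘ x∈∁p⇒x∉p ∘ ∈∩⁻ʳ) (λ _ → unit)

  pool₁ : ∀ {x z} → x ∈ M → Adj G x z → z ∈ Q → z ∉ mk → Pool z (Adj G x)
  pool₁ {x} {z} x∈M x~z z∈Q z∉mk with z ∈? A
  ... | yes z∈A = choicePool (SA x) (N G x ∩ (A ∩ Q)) (proj₁ (SA-ok x x∈M)) (proj₂ (SA-ok x x∈M)) (∈∩⁻ʳ ∘ ∈∩⁻ʳ)
                    (∈∩⁺ (∈N⁺ G x~z) (∈∩⁺ z∈A z∈Q)) z∉mk
                    (λ c∈ → inj₁ (x , x∈M , c∈)) (bothIn z∈A ∘ ∈∩⁻ˡ ∘ ∈∩⁻ʳ) (∈N⁻ G ∘ ∈∩⁻ˡ)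
  ... | no z∉A = choicePool (SN x) (N G x ∩ (Q ∩ ∁ A)) (proj₁ (SN-ok x x∈M)) (proj₂ (SN-ok x x∈M)) (∈∩⁻ˡ ∘ ∈∩⁻ʳ)
                    (∈∩⁺ (∈N⁺ G x~z) (∈∩⁺ z∈Q (x∉p⇒x∈∁p z∉A))) z∉mk
                    (λ c∈ → inj₂ (inj₁ (x , x∈M , c∈))) (bothOut z∉A ∘ x∈∁p⇒x∉p ∘ ∈∩⁻ʳ ∘ ∈∩⁻ʳ) (∈N⁻ G ∘ ∈∩⁻ˡ)

  pool₂ : ∀ {x y z} → x ∈ M → y ∈ M → x ≢ y → Adj G x z → Adj G y z → z ∉ A → z ∈ Q → z ∉ mk →
    Pool z (λ c → Adj G x c × Adj G y c)
  pool₂ {x} {y} x∈M y∈M x≢y x~z y~z z∉A z∈Q z∉mk =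
    choicePool (SP x y) ((N G x ∩ N G y) ∩ (Q ∩ ∁ A)) (proj₁ (SP-ok x y x∈M y∈M x≢y)) (proj₂ (SP-ok x y x∈M y∈M x≢y))
      (∈∩⁻ˡ ∘ ∈∩⁻ʳ) (∈∩⁺ (∈∩⁺ (∈N⁺ G x~z) (∈N⁺ G y~z)) (∈∩⁺ z∈Q (x∉p⇒x∈∁p z∉A))) z∉mk
      (λ c∈ → inj₂ (inj₂ (inj₁ (x , y , x∈M , y∈M , x≢y , c∈)))) (bothOut z∉A ∘ x∈∁p⇒x∉p ∘ ∈∩⁻ʳ ∘ ∈∩⁻ʳ)
      (λ c∈ → ∈N⁻ G (∈∩⁻ˡ (∈∩⁻ˡ c∈)) , ∈N⁻ G (∈∩⁻ʳ (∈∩⁻ˡ c∈)))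

  AdjacentIfInM : Maybe (Fin n) → Fin n → Set
  AdjacentIfInM w c = MaybeAll.All (λ x → x ∈ M → Adj G x c) w

  private
    vacuous : ∀ {w c} → ¬ MaybeAny.Any (_∈ M) w → AdjacentIfInM w c
    vacuous {nothing} _ = MaybeAll.nothing
    vacuous {just x} w∉M = MaybeAll.just (λ x∈M → contradiction (MaybeAny.just x∈M) w∉M)

  substitute : ∀ {z w w′} → z ∈ Q → z ∉ mk → Connected (Adj G) w (just z) → Connected (Adj G) (just z) w′ →
    (∀ {x y} → w ≡ just x → w′ ≡ just y → x ≢ y × z ∉ A) → Pool z (λ c → AdjacentIfInM w c × AdjacentIfInM w′ c)
  substitute {w = w} {w′} z∈Q z∉mk before after interior with MaybeAny.dec (_∈? M) w | MaybeAny.dec (_∈? M) w′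
  ... | no w∉M | no w′∉M = Pool-map (λ _ → vacuous w∉M , vacuous w′∉M) (pool₀ z∈Q z∉mk)
  ... | yes (MaybeAny.just x∈M) | no w′∉M =
    Pool-map (λ x~c → MaybeAll.just (λ _ → x~c) , vacuous w′∉M) (pool₁ x∈M (drop-just before) z∈Q z∉mk)
  ... | no w∉M | yes (MaybeAny.just y∈M) =
    Pool-map (λ y~c → vacuous w∉M , MaybeAll.just (λ _ → y~c)) (pool₁ y∈M (Adj-sym G (drop-just after)) z∈Q z∉mk)
  ... | yes (MaybeAny.just x∈M) | yes (MaybeAny.just y∈M) =
    Pool-map (λ (x~c , y~c) → MaybeAll.just (λ _ → x~c) , MaybeAll.just (λ _ → y~c))
             (pool₂ x∈M y∈M (proj₁ (interior refl refl)) (drop-just before) (Adj-sym G (drop-just after))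
                    (proj₂ (interior refl refl)) z∈Q z∉mk)

  Invariant : Subset n → Set
  Invariant C = ∀ {x y} → x ∈ Q → y ∈ Q → (x ∈ A ⇔ y ∈ A) → x ∈ C ⇔ y ∈ C

  Q-invariant : Invariant Q
  Q-invariant x∈Q y∈Q _ = mk⇔ (λ _ → y∈Q) (λ _ → x∈Q)

  AQ-invariant : Invariant (A ∩ Q)
  AQ-invariant x∈Q y∈Q x⇔y =
    mk⇔ (λ x∈ → ∈∩⁺ (Equivalence.to x⇔y (∈∩⁻ˡ x∈)) y∈Q) (λ y∈ → ∈∩⁺ (Equivalence.from x⇔y (∈∩⁻ˡ y∈)) x∈Q)

  NA-invariant : Invariant (Q ∩ ∁ A)
  NA-invariant x∈Q y∈Q x⇔y =
    mk⇔ (λ x∈ → ∈∩⁺ y∈Q (x∉p⇒x∈∁p (x∈∁p⇒x∉p (∈∩⁻ʳ x∈) ∘ Equivalence.from x⇔y)))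
        (λ y∈ → ∈∩⁺ x∈Q (x∉p⇒x∈∁p (x∈∁p⇒x∉p (∈∩⁻ʳ y∈) ∘ Equivalence.to x⇔y)))

  module _ {Z : Subset n} (Z⊆Q : Z ⊆ Q) (Z-unmarked : ∀ {z} → z ∈ Z → z ∉ mk) where

    rerouteStep : ∀ {R z} → Packing G ⊤ A ℓ R → count Q (concat R) ≤ ℓ * ∣ M ∣ → z ∈ Z → z ∈ₗ concat R →
      ∃ λ R′ → Packing G ⊤ A ℓ R′ × length R′ ≡ length R × count Z (concat R′) < count Z (concat R) ×
               (∀ C → Invariant C → count C (concat R′) ≡ count C (concat R))
    rerouteStep {R} {z} packing bound z∈Z z∈R with ∈-concat-split R z∈R
    ... | R₁ , pre , post , R₂ , refl =
      R₁ ++ (pre ++ c ∷ post) ∷ R₂ ,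
      Packing-replace G R₁ pre R₂ packing ∈⊤ c∉R (pool-side c∈pool)
        (reattachˡ before z∈Q c∈Q (λ last≡ → ≢c (∈-++⁺ˡ (∈-last pre last≡))) (proj₁ fits))
        (reattachʳ after z∈Q c∈Q (λ head≡ → ≢c (∈-++⁺ʳ pre (there (∈-head post head≡)))) (proj₂ fits)) ,
      trans (length-++ R₁) (sym (length-++ R₁)) ,
      count-concat-replace-< Z R₁ pre post R₂ z∈Z (λ c∈Z → Z-unmarked c∈Z (pool⊆mk c∈pool)) ,
      λ C invariant → count-concat-replace C R₁ pre post R₂ (invariant z∈Q c∈Q (pool-side c∈pool))
      where
        z∈Q = Z⊆Q z∈Z
        path = All.head (All.++⁻ʳ R₁ (proj₁ packing))
        neighbours = Linked-neighbours pre (proj₂ (proj₂ (proj₁ path)))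
        before = proj₁ neighbours
        after = proj₂ neighbours
        open Pool (substitute z∈Q (Z-unmarked z∈Z) before after (distinct×interior-∉ G pre path))
        room : count pool (concat R) < ∣ pool ∣
        room = begin-strict
          count pool (concat R) ≤⟨ count-mono pool⊆Q (concat R) ⟩
          count Q (concat R)    ≤⟨ bound ⟩
          ℓ * ∣ M ∣             <⟨ m<m+n (ℓ * ∣ M ∣) z<s ⟩
          ℓ * ∣ M ∣ + 1         ≡⟨ ∣pool∣ ⟨
          ∣ pool ∣              ∎
          where open ≤-Reasoning
        unused = fresh pool (concat R) room
        c = proj₁ unused
        c∈pool = proj₁ (proj₂ unused)
        c∉R = proj₂ (proj₂ unused)
        c∈Q = pool⊆Q c∈pool
        fits = pool-fits c∈pool
        ≢c : ∀ {x} → x ∈ₗ pre ++ z ∷ post → x ≢ c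
        ≢c x∈p refl = c∉R (∈-concat⁺′ x∈p (∈-++⁺ʳ R₁ (here refl)))

    reroute : ∀ fuel {R} → Packing G ⊤ A ℓ R → count Q (concat R) ≤ ℓ * ∣ M ∣ → count Z (concat R) ≤ fuel →
      ∃ λ R′ → Packing G ⊤ A ℓ R′ × length R′ ≡ length R × All (_∉ Z) (concat R′) ×
               (∀ C → Invariant C → count C (concat R′) ≡ count C (concat R))
    reroute fuel {R} packing bound budget with Any.any? (_∈? Z) (concat R)
    ... | no avoidsZ = R , packing , refl , ¬Any⇒All¬ (concat R) avoidsZ , λ _ _ → refl
    reroute zero packing bound budget | yes meetsZ = contradiction (≤-trans (count-some meetsZ) budget) λ ()
    reroute (suc fuel) packing bound budget | yes meetsZ
      with z , z∈R , z∈Z ← find meetsZ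
      with R₁ , packing₁ , length₁ , fewer , same₁ ← rerouteStep packing bound z∈Z z∈R
      with R₂ , packing₂ , length₂ , R₂∉Z , same₂ ←
             reroute fuel packing₁ (subst (_≤ ℓ * ∣ M ∣) (sym (same₁ Q Q-invariant)) bound) (≤-pred (≤-trans fewer budget))
      = R₂ , packing₂ , trans length₂ length₁ , R₂∉Z , λ C invariant → trans (same₂ C invariant) (same₁ C invariant)

-- The reduction

module Reduction {n : ℕ} (G : Graph n) (A : Subset n) (ℓ : ℕ) {M mk Q : Subset n}
  (marking : IsMarking G M A ℓ mk) (isComponent : IsCliqueOf G M Q)
  {u v : Fin n} (u∈A : u ∈ A) (u∈Q : u ∈ Q) (v∈A : v ∈ A) (v∈Q : v ∈ Q) (u≢v : u ≢ v) (u∉mk : u ∉ mk) (v∉mk : v ∉ mk)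
  {X : Subset n} (X⊆NA : X ⊆ Q ∩ ∁ A) (X-unmarked : ∀ x → x ∈ X → x ∉ mk) (∣X∣+2≡ℓ : ∣ X ∣ + 2 ≡ ℓ) where

  open Component G isComponent
  open Rerouting G A ℓ marking isComponent

  Z A′ AQ NA : Subset n
  Z = X ∪ (⁅ u ⁆ ∪ ⁅ v ⁆)
  A′ = A ─ (⁅ u ⁆ ∪ ⁅ v ⁆)
  AQ = A ∩ Q
  NA = Q ∩ ∁ A

  Xs uXv : List (Fin n)
  Xs = enumerate X
  uXv = u ∷ Xs ++ [ v ]

  Xs⊆NA : All (_∈ NA) Xs
  Xs⊆NA = All.tabulate (X⊆NA ∘ ∈-enumerate⁻)

  uXv-path : IsAPathIn G ⊤ A ℓ uXv
  uXv-path = cliquePath (∈∩⁺ u∈A u∈Q) (∈∩⁺ v∈A v∈Q) Xs⊆NA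
    (Unique-path u≢v (x∈p∩q⇒x∉q∩∁p (∈∩⁺ u∈A u∈Q) ∘ All.lookup Xs⊆NA)
                     (x∈p∩q⇒x∉q∩∁p (∈∩⁺ v∈A v∈Q) ∘ All.lookup Xs⊆NA) (enumerate-Unique X))
    (trans (cong (_+ 2) (length-enumerate X)) ∣X∣+2≡ℓ)

  uXv-inside : All (_∈ Q) uXv
  uXv-inside = u∈Q ∷ All.++⁺ (All.map ∈∩⁻ˡ Xs⊆NA) (v∈Q ∷ [])

  uXv⊆Z : All (_∈ Z) uXv
  uXv⊆Z = x∈p∪q⁺ (inj₂ (x∈p∪q⁺ (inj₁ (x∈⁅x⁆ u)))) ∷
          All.++⁺ (All.tabulate (x∈p∪q⁺ ∘ inj₁ ∘ ∈-enumerate⁻)) (x∈p∪q⁺ (inj₂ (x∈p∪q⁺ (inj₂ (x∈⁅x⁆ v)))) ∷ [])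

  Z⊆uXv : ∀ {x} → x ∈ Z → x ∈ₗ uXv
  Z⊆uXv x∈Z with x∈p∪q⁻ X _ x∈Z
  ... | inj₁ x∈X = there (∈-++⁺ˡ (∈-enumerate⁺ x∈X))
  ... | inj₂ x∈uv with x∈p∪q⁻ ⁅ u ⁆ ⁅ v ⁆ x∈uv
  ...   | inj₁ x∈u = here (x∈⁅y⁆⇒x≡y u x∈u)
  ...   | inj₂ x∈v = there (∈-++⁺ʳ Xs (here (x∈⁅y⁆⇒x≡y v x∈v)))

  Z⊆Q : Z ⊆ Q
  Z⊆Q = All.lookup uXv-inside ∘ Z⊆uXv

  Z-unmarked : ∀ {z} → z ∈ Z → z ∉ mk
  Z-unmarked = All.lookup (u∉mk ∷ All.++⁺ (All.tabulate (X-unmarked _ ∘ ∈-enumerate⁻)) (v∉mk ∷ [])) ∘ Z⊆uXv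

  uv⊆Z : (⁅ u ⁆ ∪ ⁅ v ⁆) ⊆ Z
  uv⊆Z = x∈p∪q⁺ ∘ inj₂

  profile : ∀ {S p} → IsAPathIn G S A ℓ p → All (_∈ Q) p → count AQ p ≡ 2 × count NA p ≡ ∣ X ∣
  profile path p⊆Q with count-inside path p⊆Q
  ... | two , rest = two , +-cancelʳ-≡ 2 _ _ (trans rest (sym ∣X∣+2≡ℓ))

  outsidePaths : ∀ {ps} → Packing G ⊤ A ℓ ps → ∃₂ λ R t → length ps ≡ length R + t × Packing G ⊤ A ℓ R ×
    count Q (concat R) ≤ ℓ * ∣ M ∣ × count AQ (concat R) + t * 2 ≤ ∣ AQ ∣ × count NA (concat R) + t * ∣ X ∣ ≤ ∣ NA ∣
  outsidePaths {ps} packing =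
    R , length I , length-ps , packingR , bound , room AQ (All.map proj₁ profiles) , room NA (All.map proj₂ profiles)
    where
      inside? = All.all? (_∈? Q)
      I = filter inside? ps
      R = filter (∁? inside?) ps
      ps↭I++R : ps ↭ I ++ R
      ps↭I++R = ↭-filter-split inside? ps
      packingI++R = Packing-↭ G ps↭I++R packing
      packingI = proj₁ (Packing-++⁻ G I packingI++R)
      packingR = proj₂ (Packing-++⁻ G I packingI++R)
      length-ps : length ps ≡ length R + length I
      length-ps = trans (↭-length ps↭I++R) (trans (length-++ I) (+-comm (length I) (length R)))
      bound : count Q (concat R) ≤ ℓ * ∣ M ∣
      bound = ≤-trans (count-outside-concat R (proj₁ packingR) (all-filter (∁? inside?) ps))
                      (*-monoʳ-≤ ℓ (count≤∣p∣ M (proj₂ packingR)))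
      profiles : All (λ p → count AQ p ≡ 2 × count NA p ≡ ∣ X ∣) I
      profiles = All.zipWith (λ (path , p⊆Q) → profile path p⊆Q) (proj₁ packingI , all-filter inside? ps)
      room : ∀ C {r} → All (λ p → count C p ≡ r) I → count C (concat R) + length I * r ≤ ∣ C ∣
      room C {r} counts = begin
        count C (concat R) + length I * r       ≡⟨ cong (count C (concat R) +_) (count-concat C I counts) ⟨
        count C (concat R) + count C (concat I) ≡⟨ +-comm (count C (concat R)) _ ⟩
        count C (concat I) + count C (concat R) ≡⟨ count-++ C (concat I) (concat R) ⟨
        count C (concat I ++ concat R)          ≡⟨ cong (count C) (concat-++ I R) ⟩
        count C (concat (I ++ R))               ≤⟨ count≤∣p∣ C (proj₂ packingI++R) ⟩
        ∣ C ∣                                   ∎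
        where open ≤-Reasoning

  freshPath : ∀ W → count AQ W + 2 ≤ ∣ AQ ∣ → count NA W + ∣ X ∣ ≤ ∣ NA ∣ →
    ∃ λ p → IsAPathIn G ⊤ A ℓ p × All (_∈ Q) p × All (_∉ₗ W) p
  freshPath W roomA roomN
    with a ∷ b ∷ [] , _ , (a≢b ∷ []) ∷ _ , a∈AQ ∷ b∈AQ ∷ [] , a∉W ∷ b∉W ∷ [] ← freshList AQ W 2 roomA
    with mid , length-mid , u-mid , mid⊆NA , mid∉W ← freshList NA W ∣ X ∣ roomN
    = a ∷ mid ++ [ b ] ,
      cliquePath a∈AQ b∈AQ mid⊆NA
        (Unique-path a≢b (x∈p∩q⇒x∉q∩∁p a∈AQ ∘ All.lookup mid⊆NA) (x∈p∩q⇒x∉q∩∁p b∈AQ ∘ All.lookup mid⊆NA) u-mid)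
        (trans (cong (_+ 2) length-mid) ∣X∣+2≡ℓ) ,
      ∈∩⁻ʳ a∈AQ ∷ All.++⁺ (All.map ∈∩⁻ˡ mid⊆NA) (∈∩⁻ʳ b∈AQ ∷ []) ,
      a∉W ∷ All.++⁺ mid∉W (b∉W ∷ [])

  freshPaths : ∀ t W → count AQ W + t * 2 ≤ ∣ AQ ∣ → count NA W + t * ∣ X ∣ ≤ ∣ NA ∣ →
    ∃ λ B → length B ≡ t × Packing G ⊤ A ℓ B × All (_∉ₗ W) (concat B)
  freshPaths zero W _ _ = [] , refl , ([] , []) , []
  freshPaths (suc t) W roomA roomN
    with p , path , p⊆Q , p∉W ← freshPath W (≤-trans (+-monoʳ-≤ _ (m≤m+n 2 (t * 2))) roomA)
                                             (≤-trans (+-monoʳ-≤ _ (m≤m+n ∣ X ∣ (t * ∣ X ∣))) roomN)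
    with B , length-B , (pathsB , uB) , B∉p++W ←
           freshPaths t (p ++ W) (≤-trans (≤-reflexive (count-shift AQ {2} p W t (proj₁ (profile path p⊆Q)))) roomA)
                                 (≤-trans (≤-reflexive (count-shift NA {∣ X ∣} p W t (proj₂ (profile path p⊆Q)))) roomN)
    = p ∷ B , cong suc length-B ,
      (path ∷ pathsB , Unique.++⁺ (proj₁ (proj₁ path)) uB (λ (x∈p , x∈B) → All.lookup B∉p++W x∈B (∈-++⁺ˡ x∈p))) ,
      All.++⁺ p∉W (All.map (_∘ ∈-++⁺ʳ p) B∉p++W)

  appendFresh : ∀ {R B} → Packing G ⊤ A ℓ R → All (_∉ Z) (concat R) →
    Packing G ⊤ A ℓ B → All (_∉ₗ uXv ++ concat R) (concat B) → YesInstance G (∁ Z) A′ (length R + length B) ℓ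
  appendFresh {R} {B} packingR R∉Z packingB B∉W =
    subst (λ k → YesInstance G (∁ Z) A′ k ℓ) (length-++ R)
      (Packing⇒YesInstance G (restrict-Packing G uv⊆Z (Packing-++⁺ G packingR packingB disjoint) R++B∉Z))
    where
      disjoint : Disjoint (concat R) (concat B)
      disjoint (x∈R , x∈B) = All.lookup B∉W x∈B (∈-++⁺ʳ uXv x∈R)
      R++B∉Z : All (_∉ Z) (concat (R ++ B))
      R++B∉Z = subst (All (_∉ Z)) (concat-++ R B)
        (All.++⁺ R∉Z (All.tabulate λ x∈B x∈Z → All.lookup B∉W x∈B (∈-++⁺ˡ (Z⊆uXv x∈Z))))

  refill : ∀ t {R} → Packing G ⊤ A ℓ R → All (_∉ Z) (concat R) →
    count AQ (concat R) + t * 2 ≤ ∣ AQ ∣ → count NA (concat R) + t * ∣ X ∣ ≤ ∣ NA ∣ →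
    YesInstance G (∁ Z) A′ (length R + t ∸ 1) ℓ
  refill zero {R} packing R∉Z _ _ =
    subst (λ k → YesInstance G (∁ Z) A′ (k ∸ 1) ℓ) (sym (+-identityʳ (length R)))
      (YesInstance-pred G (Packing⇒YesInstance G (restrict-Packing G uv⊆Z packing R∉Z)))
  refill (suc t) {R} packing R∉Z roomA roomN
    with B , length-B , packingB , B∉W ←
           freshPaths t (uXv ++ concat R)
             (≤-trans (≤-reflexive (count-shift AQ {2} uXv (concat R) t (proj₁ (profile uXv-path uXv-inside)))) roomA)
             (≤-trans (≤-reflexive (count-shift NA {∣ X ∣} uXv (concat R) t (proj₂ (profile uXv-path uXv-inside)))) roomN)
    = subst (λ k → YesInstance G (∁ Z) A′ k ℓ)
        (trans (cong (length R +_) length-B) (sym (cong (_∸ 1) (+-suc (length R) t))))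
        (appendFresh packing R∉Z packingB B∉W)

  forward : ∀ {k} → YesInstance G ⊤ A k ℓ → YesInstance G (∁ Z) A′ (k ∸ 1) ℓ
  forward solution
    with ps , refl , packing ← YesInstance⇒Packing G solution
    with R , t , length-ps , packingR , bound , roomA , roomN ← outsidePaths packing
    with R′ , packingR′ , length-R′ , R′∉Z , same ← reroute Z⊆Q Z-unmarked (count Z (concat R)) packingR bound ≤-refl
    = subst (λ k → YesInstance G (∁ Z) A′ (k ∸ 1) ℓ) (trans (cong (_+ t) length-R′) (sym length-ps))
        (refill t packingR′ R′∉Z (subst (λ a → a + t * 2 ≤ ∣ AQ ∣) (sym (same AQ AQ-invariant)) roomA)
                                 (subst (λ a → a + t * ∣ X ∣ ≤ ∣ NA ∣) (sym (same NA NA-invariant)) roomN))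

  backward : ∀ {k} → YesInstance G (∁ Z) A′ (k ∸ 1) ℓ → YesInstance G ⊤ A k ℓ
  backward {zero} _ = [] , refl , [] , []
  backward {suc k} (ps , length-ps , paths , disjoint) =
    uXv ∷ ps , cong suc length-ps , uXv-path ∷ All.map (lift G uv⊆Z) paths , All.map uXv-disjoint paths ∷ disjoint
    where
      uXv-disjoint : ∀ {p} → IsAPathIn G (∁ Z) A′ ℓ p → VertexDisjoint G uXv p
      uXv-disjoint ((_ , p⊆∁Z , _) , _) x x∈uXv x∈p = x∈∁p⇒x∉p (All.lookup p⊆∁Z x∈p) (All.lookup uXv⊆Z x∈uXv)

mainTheorem9 : ∀ {n : ℕ} (G : Graph n) (A : Subset n) (k ℓ : ℕ)
    (M : Subset n) → CliqueUnion G M →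
    (mk : Subset n) → IsMarking G M A ℓ mk →
    (Q : Subset n) → IsCliqueOf G M Q →
    (u v : Fin n) → u ∈ A → u ∈ Q → v ∈ A → v ∈ Q → u ≢ v → u ∉ mk → v ∉ mk →
    (X : Subset n) → X ⊆ (Q ∩ ∁ A) → (∀ x → x ∈ X → x ∉ mk) → ∣ X ∣ + 2 ≡ ℓ →
    YesInstance G ⊤ A k ℓ
      ⇔ YesInstance G (∁ (X ∪ (⁅ u ⁆ ∪ ⁅ v ⁆))) (A ─ (⁅ u ⁆ ∪ ⁅ v ⁆)) (k ∸ 1) ℓ
mainTheorem9 G A k ℓ M _ mk marking Q isComponent u v u∈A u∈Q v∈A v∈Q u≢v u∉mk v∉mk X X⊆NA X-unmarked ∣X∣+2≡ℓ =
  mk⇔ forward backward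
  where open Reduction G A ℓ marking isComponent u∈A u∈Q v∈A v∈Q u≢v u∉mk v∉mk X⊆NA X-unmarked ∣X∣+2≡ℓ
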